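{- Let $f$ be the ternary operation on $\{0,1,2\}$ defined by $f(x_1,x_2,x_3)=x_1+x_2+x_3 \pmod 2$ if $x_1,x_2,x_3\in\{0,1\}$; $f(x_1,x_2,x_3)=2$ if $x_1=x_2=x_3=2$; and otherwise $f(x_1,x_2,x_3)$ is the first element among $x_1,x_2,x_3$ (in this order) that is different from $2$. Then $\mathrm{Clo}(\{f\})$ contains a WNU operation of every odd arity, but there are no $k,\ell,j\ge 1$ such that $\mathrm{Clo}(\{f\})$ contains an operation that is symmetric on $(\underbrace{x,\dots,x}_{k},\underbrace{y,\dots,y}_{\ell},\underbrace{z,\dots,z}_{j})$.
   Context: $\mathrm{Clo}(M)$ is the clone generated by $M$. An operation $f$ is a WNU if $f(y,x,\dots,x)=f(x,y,x,\dots,x)=\dots=f(x,\dots,x,y)$ for all $x,y$. An $n$-ary operation $g$ is symmetric on a tuple of variables $(x_{i_1},\dots,x_{i_n})$ if it satisfies the identity $g(x_{i_1},\dots,x_{i_n})=g(x_{i_{\sigma(1)}},\dots,x_{i_{\sigma(n)}})$ for every permutation $\sigma$ of $\{1,\dots,n\}$. -}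

module Defs where

open import Data.Nat using (ℕ; zero; suc; _+_; _<ᵇ_)
open import Data.Fin using (Fin; zero; suc; toℕ; _≟_)
open import Data.Fin.Permutation using (Permutation′; _⟨$⟩ʳ_)
open import Data.Bool using (if_then_else_)
open import Data.Product using (Σ; _×_)
open import Relation.Nullary using (does)
open import Relation.Binary.PropositionalEquality using (_≡_)

D : Set
D = Fin 3

Op : ℕ → Set
Op n = (Fin n → D) → D

f : D → D → D → D
f zero zero zero = zero
f zero zero (suc zero) = suc zero
f zero (suc zero) zero = suc zero
f zero (suc zero) (suc zero) = zero
f (suc zero) zero zero = suc zero
f (suc zero) zero (suc zero) = zero
f (suc zero) (suc zero) zero = zero
f (suc zero) (suc zero) (suc zero) = suc zero
f (suc (suc zero)) (suc (suc zero)) (suc (suc zero)) = suc (suc zero)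
f zero _ _ = zero
f (suc zero) _ _ = suc zero
f (suc (suc zero)) zero _ = zero
f (suc (suc zero)) (suc zero) _ = suc zero
f (suc (suc zero)) (suc (suc zero)) x = x

-- terms over {f} in n variables; their term operations form Clo({f})
data Term (n : ℕ) : Set where
  var : Fin n → Term n
  app : Term n → Term n → Term n → Term n

⟦_⟧ : ∀ {n} → Term n → Op n
⟦ var i ⟧ a = a i
⟦ app s t u ⟧ a = f (⟦ s ⟧ a) (⟦ t ⟧ a) (⟦ u ⟧ a)

InClo : ∀ {n} → Op n → Set
InClo {n} g = Σ (Term n) λ t → ∀ a → ⟦ t ⟧ a ≡ g a

atPos : ∀ {n} → Fin n → D → D → Fin n → D
atPos i x y m = if does (m ≟ i) then y else x

IsWNU : ∀ {n} → Op n → Set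
IsWNU {n} g = ∀ (x y : D) (i j : Fin n) → g (atPos i x y) ≡ g (atPos j x y)

-- block pattern of (x^k, y^ℓ, z^j): position m is variable 0 (x), 1 (y) or 2 (z)
block : (k l j : ℕ) → Fin (k + l + j) → Fin 3
block k l j m =
  if toℕ m <ᵇ k then zero else (if toℕ m <ᵇ k + l then suc zero else suc (suc zero))

SymmetricOn : (k l j : ℕ) → Op (k + l + j) → Set
SymmetricOn k l j g =
  ∀ (ρ : Fin 3 → D) (σ : Permutation′ (k + l + j)) →
    g (λ m → ρ (block k l j m)) ≡ g (λ m → ρ (block k l j (σ ⟨$⟩ʳ m)))

{-# OPTIONS --safe #-}
-- For odd n = 2m + 1 the term f(x₁, x₂, f(x₃, x₄, … f(x_{n-2}, x_{n-1}, xₙ))) is a WNU: f is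
-- idempotent and f(x,y,x) = f(x,x,y) = f(y,x,x) = f(x,x,f(y,x,x)), so every tuple with one
-- deviating entry evaluates to f(y,x,x).
--
-- For the negative part fix the set s of positions holding 2. On tuples with 2-set s, a term
-- operation of f is 2 exactly when all its variables lie in s, and otherwise its value (0 or 1)
-- is a GF(2)-linear form in the entries outside s. If the operation is invariant under swapping
-- a 0-entry with a 1-entry, it is not constantly 2 (move the leftmost variable onto a 1-entry),
-- all coefficients outside s are equal, and they sum to 1 because f is conservative and hence
-- returns 1 on the tuple that is 1 outside s; so the number of non-2 entries is odd.
-- Substituting 2 for one of x, y, z and 0, 1 for the other two makes ℓ + j, k + j and k + ℓ
-- all odd, which is impossible since their sum is even.
module Submission where

open import Defs
open import Data.Nat using (ℕ; suc; _+_; _*_)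
open import Data.Product using (Σ; _×_)
open import Relation.Nullary using (¬_)

open import Algebra.Bundles using (CommutativeRing)
open import Data.Bool using (Bool; true; false; not; _∧_; _∨_; _xor_; if_then_else_)
import Data.Bool.Properties as Bool
open import Data.Bool.Properties
  using ( xor-∧-commutativeRing; xor-identityʳ; ∧-comm; ∧-zeroʳ; ∧-conicalʳ
        ; ∧-distribˡ-xor; ∧-distribʳ-xor )
open import Data.Fin using (Fin; zero; suc; toℕ; fromℕ<; _↑ʳ_; _≟_)
open import Data.Fin.Patterns using (0F; 1F; 2F)
open import Data.Fin.Permutation using (transpose)
import Data.Fin.Permutation.Components as PC
open import Data.Fin.Properties using (all?; toℕ-fromℕ<)
open import Data.Nat using (_<_; _≤_; _<ᵇ_; z≤n; s≤s; z<s)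
open import Data.Nat.Properties using (+-suc; ≤-refl; m≤m+n; m<m+n; <-≤-trans)
open import Data.Product using (_,_; proj₂; ∃; map₂)
open import Data.Sum using (_⊎_; inj₁; inj₂)
open import Function using (_∘_)
open import Relation.Nullary using (does; yes; no; contradiction)
open import Relation.Nullary.Decidable using (from-yes; dec-true; _⊎-dec_)
open import Relation.Binary.PropositionalEquality
  using (_≡_; refl; sym; trans; cong; cong₂; subst; module ≡-Reasoning)

open CommutativeRing xor-∧-commutativeRing using (semiring; +-group)
open import Algebra.Properties.Semiring.Sum semiring
  using (sum-syntax; sum-cong-≗; sum-replicate-zero; ∑-distrib-+; ∑-comm; *-distribˡ-sum)
open import Algebra.Properties.Group +-group using (identityʳ-unique; inverseʳ-unique)

cong₃ : ∀ {A B C R : Set} (h : A → B → C → R) {x x′ y y′ z z′} →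
        x ≡ x′ → y ≡ y′ → z ≡ z′ → h x y z ≡ h x′ y′ z′
cong₃ h refl refl refl = refl

rename : ∀ {n k} → (Fin n → Fin k) → Term n → Term k
rename r (var i)     = var (r i)
rename r (app x y z) = app (rename r x) (rename r y) (rename r z)

⟦rename⟧ : ∀ {n k} (r : Fin n → Fin k) t a → ⟦ rename r t ⟧ a ≡ ⟦ t ⟧ (λ i → a (r i))
⟦rename⟧ r (var i)     a = refl
⟦rename⟧ r (app x y z) a = cong₃ f (⟦rename⟧ r x a) (⟦rename⟧ r y a) (⟦rename⟧ r z a)

f-conservative : ∀ x y z → f x y z ≡ x ⊎ f x y z ≡ y ⊎ f x y z ≡ z
f-conservative = from-yes (all? λ x → all? λ y → all? λ z →
  f x y z ≟ x ⊎-dec f x y z ≟ y ⊎-dec f x y z ≟ z)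

⟦⟧-conservative : ∀ {n} (t : Term n) a → ∃ λ m → ⟦ t ⟧ a ≡ a m
⟦⟧-conservative (var i)     a = i , refl
⟦⟧-conservative (app x y z) a with f-conservative (⟦ x ⟧ a) (⟦ y ⟧ a) (⟦ z ⟧ a)
... | inj₁ e        = map₂ (trans e) (⟦⟧-conservative x a)
... | inj₂ (inj₁ e) = map₂ (trans e) (⟦⟧-conservative y a)
... | inj₂ (inj₂ e) = map₂ (trans e) (⟦⟧-conservative z a)

⟦⟧-idempotent : ∀ {n} (t : Term n) x → ⟦ t ⟧ (λ _ → x) ≡ x
⟦⟧-idempotent t x = proj₂ (⟦⟧-conservative t (λ _ → x))

data Odd : ℕ → Set where
  one : Odd 1
  2+_ : ∀ {n} → Odd n → Odd (suc (suc n))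

odd-2m+1 : ∀ m → Odd (suc (2 * m))
odd-2m+1 0       = one
odd-2m+1 (suc m) = subst Odd (cong (2 +_) (sym (+-suc m (m + 0)))) (2+ odd-2m+1 m)

wnu : ∀ {n} → Odd n → Term n
wnu one    = var 0F
wnu (2+ o) = app (var 0F) (var 1F) (rename (2 ↑ʳ_) (wnu o))

wnuValue : ∀ {n} → Odd n → D → D → D
wnuValue one    x y = y
wnuValue (2+ _) x y = f y x x

f-xyx : ∀ x y → f x y x ≡ f y x x
f-xyx = from-yes (all? λ x → all? λ y → f x y x ≟ f y x x)

f-xx-wnuValue : ∀ {n} (o : Odd n) x y → f x x (wnuValue o x y) ≡ f y x x
f-xx-wnuValue one    = from-yes (all? λ x → all? λ y → f x x y ≟ f y x x)
f-xx-wnuValue (2+ _) = from-yes (all? λ x → all? λ y → f x x (f y x x) ≟ f y x x)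

⟦wnu-2+⟧ : ∀ {n} (o : Odd n) a →
  ⟦ wnu (2+ o) ⟧ a ≡ f (a 0F) (a 1F) (⟦ wnu o ⟧ (λ i → a (2 ↑ʳ i)))
⟦wnu-2+⟧ o a = cong (f (a 0F) (a 1F)) (⟦rename⟧ (2 ↑ʳ_) (wnu o) a)

wnu-atPos : ∀ {n} (o : Odd n) x y i → ⟦ wnu o ⟧ (atPos i x y) ≡ wnuValue o x y
wnu-atPos one    x y 0F = refl
wnu-atPos (2+ o) x y 0F =
  trans (⟦wnu-2+⟧ o _) (cong (f y x) (⟦⟧-idempotent (wnu o) x))
wnu-atPos (2+ o) x y 1F =
  trans (⟦wnu-2+⟧ o _) (trans (cong (f x y) (⟦⟧-idempotent (wnu o) x)) (f-xyx x y))
wnu-atPos (2+ o) x y (suc (suc i)) =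
  trans (⟦wnu-2+⟧ o _) (trans (cong (f x x) (wnu-atPos o x y i)) (f-xx-wnuValue o x y))

wnu-isWNU : ∀ {n} (o : Odd n) → IsWNU ⟦ wnu o ⟧
wnu-isWNU o x y i j = trans (wnu-atPos o x y i) (sym (wnu-atPos o x y j))

infix 8 _·_

_·_ : ∀ {n} → (Fin n → Bool) → (Fin n → Bool) → Bool
_·_ {n} c b = ∑[ m < n ] (c m ∧ b m)

δ : ∀ {n} → Fin n → Fin n → Bool
δ p m = does (m ≟ p)

δ-· : ∀ {n} p (b : Fin n → Bool) → δ p · b ≡ b p
δ-· {suc n} 0F      b = trans (cong (b 0F xor_) (sum-replicate-zero n)) (xor-identityʳ (b 0F))
δ-· {suc n} (suc p) b = δ-· p (b ∘ suc)

·-δ : ∀ {n} (c : Fin n → Bool) p → c · δ p ≡ c p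
·-δ c p = trans (sum-cong-≗ (λ m → ∧-comm (c m) (δ p m))) (δ-· p c)

·-xorˡ : ∀ {n} (u v b : Fin n → Bool) → (λ m → u m xor v m) · b ≡ u · b xor v · b
·-xorˡ u v b = trans (sum-cong-≗ (λ m → ∧-distribʳ-xor (b m) (u m) (v m)))
                     (∑-distrib-+ (λ m → u m ∧ b m) (λ m → v m ∧ b m))

·-xorʳ : ∀ {n} (c u v : Fin n → Bool) → c · (λ m → u m xor v m) ≡ c · u xor c · v
·-xorʳ c u v = trans (sum-cong-≗ (λ m → ∧-distribˡ-xor (c m) (u m) (v m)))
                     (∑-distrib-+ (λ m → c m ∧ u m) (λ m → c m ∧ v m))

isTwo : D → Bool
isTwo 2F = true
isTwo _  = false

isOne : D → Bool
isOne 1F = true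
isOne _  = false

fOne : Bool → Bool → Bool → Bool → Bool → Bool → Bool
fOne tx ty tz u v w =
  if tx then (if ty then w else v) else (if ty ∨ tz then u else u xor v xor w)

isTwo-f : ∀ x y z → isTwo (f x y z) ≡ isTwo x ∧ isTwo y ∧ isTwo z
isTwo-f = from-yes (all? λ x → all? λ y → all? λ z →
  isTwo (f x y z) Bool.≟ isTwo x ∧ isTwo y ∧ isTwo z)

isOne-f : ∀ x y z →
  isOne (f x y z) ≡ fOne (isTwo x) (isTwo y) (isTwo z) (isOne x) (isOne y) (isOne z)
isOne-f = from-yes (all? λ x → all? λ y → all? λ z →
  isOne (f x y z) Bool.≟ fOne (isTwo x) (isTwo y) (isTwo z) (isOne x) (isOne y) (isOne z))

fOne-· : ∀ {n} tx ty tz (u v w b : Fin n → Bool) →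
  (λ m → fOne tx ty tz (u m) (v m) (w m)) · b ≡ fOne tx ty tz (u · b) (v · b) (w · b)
fOne-· true  true  tz    u v w b = refl
fOne-· true  false tz    u v w b = refl
fOne-· false true  tz    u v w b = refl
fOne-· false false true  u v w b = refl
fOne-· false false false u v w b = trans (·-xorˡ u _ b) (cong (u · b xor_) (·-xorˡ v w b))

module Shape {n : ℕ} (s : Fin n → Bool) where

  HasShape : (Fin n → D) → Set
  HasShape a = ∀ m → isTwo (a m) ≡ s m

  yieldsTwo : Term n → Bool
  yieldsTwo (var i)     = s i
  yieldsTwo (app x y z) = yieldsTwo x ∧ yieldsTwo y ∧ yieldsTwo z

  coeff : Term n → Fin n → Bool
  coeff (var i)       = δ i
  coeff (app x y z) m =
    fOne (yieldsTwo x) (yieldsTwo y) (yieldsTwo z) (coeff x m) (coeff y m) (coeff z m)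

  isTwo-⟦⟧ : ∀ t {a} → HasShape a → isTwo (⟦ t ⟧ a) ≡ yieldsTwo t
  isTwo-⟦⟧ (var i)     sh = sh i
  isTwo-⟦⟧ (app x y z) sh =
    trans (isTwo-f (⟦ x ⟧ _) (⟦ y ⟧ _) (⟦ z ⟧ _))
          (cong₃ (λ u v w → u ∧ v ∧ w) (isTwo-⟦⟧ x sh) (isTwo-⟦⟧ y sh) (isTwo-⟦⟧ z sh))

  isOne-⟦⟧ : ∀ t {a} → HasShape a → isOne (⟦ t ⟧ a) ≡ coeff t · (isOne ∘ a)
  isOne-⟦⟧ (var i)     {a} sh = sym (δ-· i (isOne ∘ a))
  isOne-⟦⟧ (app x y z) {a} sh = begin
    isOne (f X Y Z)
      ≡⟨ isOne-f X Y Z ⟩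
    fOne (isTwo X) (isTwo Y) (isTwo Z) (isOne X) (isOne Y) (isOne Z)
      ≡⟨ cong₃ (λ tx ty tz → fOne tx ty tz (isOne X) (isOne Y) (isOne Z))
               (isTwo-⟦⟧ x sh) (isTwo-⟦⟧ y sh) (isTwo-⟦⟧ z sh) ⟩
    fOne tx ty tz (isOne X) (isOne Y) (isOne Z)
      ≡⟨ cong₃ (fOne tx ty tz) (isOne-⟦⟧ x sh) (isOne-⟦⟧ y sh) (isOne-⟦⟧ z sh) ⟩
    fOne tx ty tz (coeff x · b) (coeff y · b) (coeff z · b)
      ≡⟨ fOne-· tx ty tz (coeff x) (coeff y) (coeff z) b ⟨
    coeff (app x y z) · b
      ∎
    where
    open ≡-Reasoning
    X = ⟦ x ⟧ a
    Y = ⟦ y ⟧ a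
    Z = ⟦ z ⟧ a
    tx = yieldsTwo x
    ty = yieldsTwo y
    tz = yieldsTwo z
    b = isOne ∘ a

  oneOff : Fin n → D
  oneOff m = if s m then 2F else 1F

  oneOff-hasShape : HasShape oneOff
  oneOff-hasShape m with s m
  ... | true  = refl
  ... | false = refl

  isOne-oneOff : ∀ m → isOne (oneOff m) ≡ not (s m)
  isOne-oneOff m with s m
  ... | true  = refl
  ... | false = refl

  coeff-·-not : ∀ t → yieldsTwo t ≡ false → coeff t · (not ∘ s) ≡ true
  coeff-·-not t alive with ⟦⟧-conservative t oneOff
  ... | m , eq = begin
    coeff t · (not ∘ s)        ≡⟨ sum-cong-≗ (λ m → cong (coeff t m ∧_) (isOne-oneOff m)) ⟨
    coeff t · (isOne ∘ oneOff) ≡⟨ isOne-⟦⟧ t oneOff-hasShape ⟨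
    isOne (⟦ t ⟧ oneOff)       ≡⟨ cong isOne eq ⟩
    isOne (oneOff m)           ≡⟨ isOne-oneOff m ⟩
    not (s m)                  ≡⟨ cong not s-m≡false ⟩
    true                       ∎
    where
    open ≡-Reasoning
    s-m≡false : s m ≡ false
    s-m≡false = begin
      s m                  ≡⟨ oneOff-hasShape m ⟨
      isTwo (oneOff m)     ≡⟨ cong isTwo eq ⟨
      isTwo (⟦ t ⟧ oneOff) ≡⟨ isTwo-⟦⟧ t oneOff-hasShape ⟩
      yieldsTwo t          ≡⟨ alive ⟩
      false                ∎

leftmost : ∀ {n} → Term n → Fin n
leftmost (var i)     = i
leftmost (app x _ _) = leftmost x

isTwo-⟦⟧-leftmost : ∀ {n} (t : Term n) a →
  isTwo (a (leftmost t)) ≡ false → isTwo (⟦ t ⟧ a) ≡ false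
isTwo-⟦⟧-leftmost (var i)     a h = h
isTwo-⟦⟧-leftmost (app x y z) a h =
  trans (isTwo-f (⟦ x ⟧ a) (⟦ y ⟧ a) (⟦ z ⟧ a))
        (cong (_∧ isTwo (⟦ y ⟧ a) ∧ isTwo (⟦ z ⟧ a)) (isTwo-⟦⟧-leftmost x a h))

transpose-matchˡ : ∀ {n} (p q : Fin n) → PC.transpose p q p ≡ q
transpose-matchˡ p q rewrite dec-true (p ≟ p) refl = refl

transpose-≗ : ∀ {n} {A : Set} (h : Fin n → A) {p q} →
  h p ≡ h q → ∀ m → h (PC.transpose p q m) ≡ h m
transpose-≗ h {p} {q} hp≡hq m with m ≟ p
... | yes refl = sym hp≡hq
... | no _ with m ≟ q
...   | yes refl = hp≡hq
...   | no _     = refl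

isOne-transpose : ∀ {n} (a : Fin n → D) {p q} → a p ≡ 0F → a q ≡ 1F →
  ∀ m → isOne (a (PC.transpose p q m)) ≡ isOne (a m) xor (δ p m xor δ q m)
isOne-transpose a {p} {q} ap aq m with m ≟ p
... | yes refl with m ≟ q
...   | yes refl with () ← trans (sym ap) aq
...   | no _     rewrite ap | aq = refl
isOne-transpose a {p} {q} ap aq m | no _ with m ≟ q
...   | yes refl rewrite ap | aq = refl
...   | no _     = sym (xor-identityʳ _)

SwapInvariantAt : ∀ {n} → Op n → (Fin n → D) → Set
SwapInvariantAt g a = ∀ p q → g a ≡ g (λ m → a (PC.transpose p q m))

module SwapInvariant {n} (t : Term n) (a : Fin n → D) (inv : SwapInvariantAt ⟦ t ⟧ a) where
  open Shape (λ m → isTwo (a m))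
  open ≡-Reasoning

  not-yieldsTwo : ∀ {q} → isTwo (a q) ≡ false → yieldsTwo t ≡ false
  not-yieldsTwo {q} aq = begin
    yieldsTwo t                                  ≡⟨ isTwo-⟦⟧ t (λ _ → refl) ⟨
    isTwo (⟦ t ⟧ a)                              ≡⟨ cong isTwo (inv r q) ⟩
    isTwo (⟦ t ⟧ (λ m → a (PC.transpose r q m))) ≡⟨ isTwo-⟦⟧-leftmost t _ ar ⟩
    false                                        ∎
    where
    r = leftmost t
    ar : isTwo (a (PC.transpose r q r)) ≡ false
    ar = trans (cong (λ m → isTwo (a m)) (transpose-matchˡ r q)) aq

  coeff-swap : ∀ {p q} → a p ≡ 0F → a q ≡ 1F → coeff t p ≡ coeff t q
  coeff-swap {p} {q} ap aq =
    sym (inverseʳ-unique (c p) (c q) (identityʳ-unique (c · b) (c p xor c q) (sym swapped)))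
    where
    c = coeff t
    b = λ m → isOne (a m)
    τ = PC.transpose p q
    τ-hasShape : HasShape (λ m → a (τ m))
    τ-hasShape = transpose-≗ (λ m → isTwo (a m)) (trans (cong isTwo ap) (sym (cong isTwo aq)))
    swapped : c · b ≡ c · b xor (c p xor c q)
    swapped = begin
      c · b                                 ≡⟨ isOne-⟦⟧ t (λ _ → refl) ⟨
      isOne (⟦ t ⟧ a)                       ≡⟨ cong isOne (inv p q) ⟩
      isOne (⟦ t ⟧ (λ m → a (τ m)))         ≡⟨ isOne-⟦⟧ t τ-hasShape ⟩
      c · (λ m → b (τ m))                   ≡⟨ sum-cong-≗ (λ m → cong (c m ∧_) (isOne-transpose a ap aq m)) ⟩
      c · (λ m → b m xor (δ p m xor δ q m)) ≡⟨ ·-xorʳ c b (λ m → δ p m xor δ q m) ⟩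
      c · b xor c · (λ m → δ p m xor δ q m) ≡⟨ cong (c · b xor_) (·-xorʳ c (δ p) (δ q)) ⟩
      c · b xor (c · δ p xor c · δ q)       ≡⟨ cong (c · b xor_) (cong₂ _xor_ (·-δ c p) (·-δ c q)) ⟩
      c · b xor (c p xor c q)               ∎

  nonTwo-odd : ∀ {p q} → a p ≡ 0F → a q ≡ 1F → ∑[ m < n ] not (isTwo (a m)) ≡ true
  nonTwo-odd {p} {q} ap aq = ∧-conicalʳ (c q) (∑[ m < n ] not (isTwo (a m))) (begin
    c q ∧ ∑[ m < n ] not (isTwo (a m))   ≡⟨ *-distribˡ-sum (c q) (λ m → not (isTwo (a m))) ⟩
    ∑[ m < n ] (c q ∧ not (isTwo (a m))) ≡⟨ sum-cong-≗ constant ⟨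
    c · (λ m → not (isTwo (a m)))        ≡⟨ coeff-·-not t (not-yieldsTwo (cong isTwo aq)) ⟩
    true                                 ∎)
    where
    c = coeff t
    constant : ∀ m → c m ∧ not (isTwo (a m)) ≡ c q ∧ not (isTwo (a m))
    constant m with a m in am
    ... | 0F = cong (_∧ true) (coeff-swap am aq)
    ... | 1F = cong (_∧ true) (trans (sym (coeff-swap ap am)) (coeff-swap ap aq))
    ... | 2F = trans (∧-zeroʳ (c m)) (sym (∧-zeroʳ (c q)))

<ᵇ≡true : ∀ {m n} → m < n → (m <ᵇ n) ≡ true
<ᵇ≡true {0}     (s≤s _)   = refl
<ᵇ≡true {suc m} (s≤s m<n) = <ᵇ≡true m<n

<ᵇ≡false : ∀ {m n} → n ≤ m → (m <ᵇ n) ≡ false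
<ᵇ≡false z≤n       = refl
<ᵇ≡false (s≤s n≤m) = <ᵇ≡false n≤m

block-toℕ : ∀ K L J (m : Fin (K + L + J)) {N} → toℕ m ≡ N →
  block K L J m ≡ (if N <ᵇ K then 0F else (if N <ᵇ K + L then 1F else 2F))
block-toℕ K L J m refl = refl

block-surjective : ∀ k l j (i : Fin 3) → ∃ λ m → block (suc k) (suc l) (suc j) m ≡ i
block-surjective k l j = λ where
    0F → zero , refl
    1F → fromℕ< K<n , trans (block-toℕ K L J _ (toℕ-fromℕ< K<n))
                            (cong₂ ifs (<ᵇ≡false (≤-refl {K})) (<ᵇ≡true (m<m+n K z<s)))
    2F → fromℕ< K+L<n , trans (block-toℕ K L J _ (toℕ-fromℕ< K+L<n))
                              (cong₂ ifs (<ᵇ≡false (m≤m+n K L)) (<ᵇ≡false (≤-refl {K + L})))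
  where
  K = suc k
  L = suc l
  J = suc j
  ifs : Bool → Bool → Fin 3
  ifs b b′ = if b then 0F else (if b′ then 1F else 2F)
  K<n : K < K + L + J
  K<n = <-≤-trans (m<m+n K z<s) (m≤m+n (K + L) J)
  K+L<n : K + L < K + L + J
  K+L<n = m<m+n (K + L) z<s

twoAt : Fin 3 → Fin 3 → D
twoAt 0F 0F = 2F
twoAt 0F 1F = 0F
twoAt 0F 2F = 1F
twoAt 1F 0F = 0F
twoAt 1F 1F = 2F
twoAt 1F 2F = 1F
twoAt 2F 0F = 0F
twoAt 2F 1F = 1F
twoAt 2F 2F = 2F

twoAt-hits-0-1 : ∀ i → ∃ λ u → ∃ λ v → twoAt i u ≡ 0F × twoAt i v ≡ 1F
twoAt-hits-0-1 0F = 1F , 2F , refl , refl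
twoAt-hits-0-1 1F = 0F , 2F , refl , refl
twoAt-hits-0-1 2F = 0F , 1F , refl , refl

∑-not-isTwo-twoAt : ∀ v → ∑[ i < 3 ] not (isTwo (twoAt i v)) ≡ false
∑-not-isTwo-twoAt 0F = refl
∑-not-isTwo-twoAt 1F = refl
∑-not-isTwo-twoAt 2F = refl

no-symmetric : ∀ k l j → ¬ (Σ (Op (suc k + suc l + suc j)) λ g →
  InClo g × SymmetricOn (suc k) (suc l) (suc j) g)
no-symmetric k l j (_ , (t , t≗g) , g-sym) = contradiction parity λ ()
  where
  n = suc k + suc l + suc j
  β = block (suc k) (suc l) (suc j)

  odd : ∀ i → ∑[ m < n ] not (isTwo (twoAt i (β m))) ≡ true
  odd i with twoAt-hits-0-1 i
  ... | u , v , u↦0 , v↦1 with block-surjective k l j u | block-surjective k l j v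
  ... | p , p↦u | q , q↦v =
    SwapInvariant.nonTwo-odd t a swapInvariant {p} {q}
      (trans (cong (twoAt i) p↦u) u↦0) (trans (cong (twoAt i) q↦v) v↦1)
    where
    a = λ m → twoAt i (β m)
    swapInvariant : SwapInvariantAt ⟦ t ⟧ a
    swapInvariant p′ q′ = trans (t≗g _) (trans (g-sym (twoAt i) (transpose p′ q′)) (sym (t≗g _)))

  parity : true ≡ false
  parity = begin
    ∑[ i < 3 ] true                                   ≡⟨ sum-cong-≗ odd ⟨
    ∑[ i < 3 ] ∑[ m < n ] not (isTwo (twoAt i (β m))) ≡⟨ ∑-comm (λ i m → not (isTwo (twoAt i (β m)))) ⟩
    ∑[ m < n ] ∑[ i < 3 ] not (isTwo (twoAt i (β m))) ≡⟨ sum-cong-≗ (∑-not-isTwo-twoAt ∘ β) ⟩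
    ∑[ m < n ] false                                  ≡⟨ sum-replicate-zero n ⟩
    false                                             ∎
    where open ≡-Reasoning

lemma1p3 : ((m : ℕ) → Σ (Op (suc (2 * m))) λ g → InClo g × IsWNU g)
    × (∀ (k l j : ℕ) → ¬ (Σ (Op (suc k + suc l + suc j)) λ g →
        InClo g × SymmetricOn (suc k) (suc l) (suc j) g))
lemma1p3 = (λ m → let o = odd-2m+1 m in ⟦ wnu o ⟧ , (wnu o , λ _ → refl) , wnu-isWNU o)
         , no-symmetric
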